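{- Let $\mathfrak{B}$ be the structure with domain $V(\mathbb{C}_3)$ in the signature consisting of the $16$ elements of the relation algebra $56_{65}$, defined by: $(x,y)\in N^{\mathfrak{B}}$ iff $x\ne y$ and $xy\notin E(\overline{\mathbb{C}_3})$; $(x,y)\in 0^{\mathfrak{B}}$ (resp. $1^{\mathfrak{B}}$) iff $x\neq y$, $xy\in E(\overline{\mathbb{C}_3})$ and $\sigma_{\overline{\mathbb{C}_3}}(xy)=0$ (resp. $=1$); $\mathrm{id}^{\mathfrak{B}}$ is equality; and each element $a$ (a set of atoms) is interpreted as the union of the interpretations of the atoms in $a$. Then $\mathfrak{B}$ pp-constructs $K_3$.
   Context: The graph $\mathbb{C}_3$ has as vertices the unit complex numbers with rational argument (range of $\arg$ is $(-\pi,\pi]$), two distinct vertices $z,w$ being adjacent iff $|\arg(z/w)|>\frac{2}{3}\pi$; $\overline{\mathbb{C}_3}$ is its complement. The relation algebra $56_{65}$ has atoms $\mathrm{id},N,0,1$ and its elements are all subsets of the set of atoms. A labelling $\sigma\colon E\to\mathbb{Z}_2$ is anti-even-balancing if every induced cycle $C$ has $\sum_{e\in E(C)}\sigma(e)=0$ if $|V(C)|=3$ and $=1$ otherwise. The labelling $\sigma_{\overline{\mathbb{C}_3}}$ is defined from fixed data: a partition $V(\overline{\mathbb{C}_3})=C_0\cup C_1$ into two disjoint subsets each dense in the unit circle, with $i(x)$ such that $x\in C_{i(x)}$; a set $P=\{p^0,\dots,p^4\}$ of vertices inducing a $5$-cycle in $\overline{\mathbb{C}_3}$ with $p^jp^{j+1}$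 edges (indices mod $5$); for each vertex $x$, $p_x:=p^j$ for the smallest $j$ with $xp^j\in E(\overline{\mathbb{C}_3})$; $T$ is the spanning tree with edges $\{xp_x\}$, $\sigma_T(xp_x)=i(x)$, and $\sigma_{\overline{\mathbb{C}_3}}$ is the unique anti-even-balancing labelling of $\overline{\mathbb{C}_3}$ extending $\sigma_T$. $K_3$ is the complete graph on three vertices (as a structure with one symmetric binary edge relation). A structure $\mathfrak{A}$ pp-constructs $\mathfrak{D}$ if $\mathfrak{D}$ is homomorphically equivalent to a pp-power of $\mathfrak{A}$, where a pp-power of $\mathfrak{A}$ is a structure with domain $A^n$ for some $n\ge1$ each of whose $k$-ary relations, viewed as a $kn$-ary relation on $A$, is primitive-positive definable in $\mathfrak{A}$. -}

module Defs where

open import Data.Bool using (Bool; true; false; _xor_; if_then_else_)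
open import Data.Nat as ℕ using (ℕ; zero; suc)
open import Data.Nat.DivMod using (_mod_)
open import Data.Integer as ℤ using (ℤ)
open import Data.Rational using (ℚ; _<_; _+_; _-_; _*_; _/_; ∣_∣; 0ℚ)
open import Data.Fin using (Fin; toℕ)
import Data.Fin
open import Data.Vec using (Vec; _++_; lookup)
open import Data.Product using (Σ; ∃; _×_; _,_)
open import Data.Sum using (_⊎_)
open import Relation.Binary.PropositionalEquality using (_≡_; _≢_)
open import Relation.Nullary using (¬_)

-- Comparing rationals with π, without reals.
-- S (2n) increase to π from below, S (2n+1) decrease to π from above.
-- As π is irrational, for rational x:  x < π  iff  ∃ n. x < S (2n),
-- and  π < x  iff  ∃ n. S (2n+1) < x.

leibnizTerm : ℕ → ℚ
leibnizTerm j = (sgn j ℤ.* ℤ.+ 4) / suc (2 ℕ.* j)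
  where
  sgn : ℕ → ℤ
  sgn zero = ℤ.+ 1
  sgn (suc zero) = ℤ.-[1+ 0 ]
  sgn (suc (suc k)) = sgn k

S : ℕ → ℚ
S zero = 0ℚ
S (suc k) = S k + leibnizTerm k

LtPi : ℚ → Set
LtPi x = ∃ λ n → x < S (2 ℕ.* n)

GtPi : ℚ → Set
GtPi x = ∃ λ n → S (suc (2 ℕ.* n)) < x

-- Vertices of ℂ₃: unit complex numbers e^{iθ} with θ ∈ ℚ ∩ (-π, π]
-- (θ = π is impossible for rational θ, so the range is |θ| < π).
-- A vertex is represented by its argument θ.

record V : Set where
  constructor vtx
  field
    arg : ℚ
    .inRange : LtPi ∣ arg ∣
open V public

-- z w adjacent in ℂ₃ iff |arg(z/w)| > 2π/3.  With d = |arg z - arg w| ∈ [0,2π),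
-- |arg(z/w)| = min(d, 2π - d), so this holds iff 2π/3 < d < 4π/3,
-- i.e. π < (3/2)·d and (3/4)·d < π.
AdjC3 : V → V → Set
AdjC3 z w = arg z ≢ arg w
          × GtPi ((ℤ.+ 3 / 2) * ∣ arg z - arg w ∣)
          × LtPi ((ℤ.+ 3 / 4) * ∣ arg z - arg w ∣)

E : V → V → Set
E z w = arg z ≢ arg w × ¬ AdjC3 z w

next : ∀ {n} → Fin (suc n) → Fin (suc n)
next {n} i = suc (toℕ i) mod suc n

-- xor-sum (sum in ℤ₂, with Bool: false = 0, true = 1)
xorSum : ∀ n → (Fin n → Bool) → Bool
xorSum zero f = false
xorSum (suc n) f = f Data.Fin.zero xor xorSum n (λ i → f (Data.Fin.suc i))

InducedCycle : ∀ {m} → (Fin (3 ℕ.+ m) → V) → Set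
InducedCycle c =
    (∀ i j → i ≢ j → arg (c i) ≢ arg (c j))
  × (∀ i → E (c i) (c (next i)))
  × (∀ i j → E (c i) (c j) → j ≡ next i ⊎ i ≡ next j)

-- labellings E → ℤ₂, represented by a symmetric function on edges
SymmetricOnEdges : (V → V → Bool) → Set
SymmetricOnEdges σ = ∀ x y → E x y → σ x y ≡ σ y x

AntiEvenBalancing : (V → V → Bool) → Set
AntiEvenBalancing σ = ∀ m (c : Fin (3 ℕ.+ m) → V) → InducedCycle c →
  xorSum (3 ℕ.+ m) (λ i → σ (c i) (c (next i))) ≡ isLonger m
  where
  isLonger : ℕ → Bool
  isLonger zero = false
  isLonger (suc _) = true

-- C_b = { x | i x ≡ b } is dense in the unit circle
-- (every open arc between two vertices contains a point of C_b;
--  vertex arguments are dense in (-π,π), so this is density in the circle)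
Dense : (V → Bool) → Bool → Set
Dense i b = ∀ u v → arg u < arg v →
  ∃ λ x → i x ≡ b × arg u < arg x × arg x < arg v

-- σ extends σ_T: for x (other than the root p⁰) and the smallest
-- j with x pʲ ∈ E, we have σ(x pʲ) = i(x).
ExtendsT : (V → Bool) → (Fin 5 → V) → (V → V → Bool) → Set
ExtendsT i P σ = ∀ x j → arg x ≢ arg (P Data.Fin.zero) → E x (P j) →
  (∀ j' → j' Data.Fin.< j → ¬ E x (P j')) → σ x (P j) ≡ i x

-- The relation algebra 56₆₅: atoms id, N, 0, 1; elements = sets of atoms.

data Atom : Set where
  aid aN a0 a1 : Atom

Element : Set
Element = Atom → Bool

AtomRel : (V → V → Bool) → Atom → V → V → Set
AtomRel σ aid x y = arg x ≡ arg y
AtomRel σ aN  x y = arg x ≢ arg y × ¬ E x y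
AtomRel σ a0  x y = arg x ≢ arg y × E x y × σ x y ≡ false
AtomRel σ a1  x y = arg x ≢ arg y × E x y × σ x y ≡ true

Rel𝔅 : (V → V → Bool) → Element → V → V → Set
Rel𝔅 σ a x y = ∃ λ t → a t ≡ true × AtomRel σ t x y

data PP (n : ℕ) : Set where
  rel : Element → Fin n → Fin n → PP n
  eq  : Fin n → Fin n → PP n
  tt  : PP n
  _∧_ : PP n → PP n → PP n
  ex  : PP (suc n) → PP n

⟦_⟧ : ∀ {n} → PP n → (V → V → Bool) → (Fin n → V) → Set
⟦ rel a i j ⟧ σ ρ = Rel𝔅 σ a (ρ i) (ρ j)
⟦ eq i j ⟧ σ ρ = ρ i ≡ ρ j
⟦ tt ⟧ σ ρ = Data.Unit.⊤ where import Data.Unit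
⟦ φ ∧ ψ ⟧ σ ρ = ⟦ φ ⟧ σ ρ × ⟦ ψ ⟧ σ ρ
⟦ ex φ ⟧ σ ρ = Σ V λ v → ⟦ φ ⟧ σ (λ { Data.Fin.zero → v ; (Data.Fin.suc i) → ρ i })

-- 𝔅 pp-constructs K₃: there is a pp-power of 𝔅 (domain Vⁿ, n ≥ 1, one binary
-- relation R whose 2n-ary version is defined by a pp-formula φ) that is
-- homomorphically equivalent to K₃.
PPConstructsK3 : (V → V → Bool) → Set
PPConstructsK3 σ = Σ ℕ λ m → Σ (PP (suc m ℕ.+ suc m)) λ φ →
  let R : Vec V (suc m) → Vec V (suc m) → Set
      R a b = ⟦ φ ⟧ σ (lookup (a ++ b))
  in  (Σ (Vec V (suc m) → Fin 3) λ h → ∀ a b → R a b → h a ≢ h b)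
    × (Σ (Fin 3 → Vec V (suc m)) λ g → ∀ i j → i ≢ j → R (g i) (g j))

-- Take the pp-power of 𝔅 on quadruples with
--   R (r s t x) (r′ s′ t′ y)  iff  (r, s, t) = (r′, s′, t′), N(r, s), r and s are E-adjacent to
--   t, x and y, (t, x) and (t, y) lie in {N, 0}, and (x, y) lies in {N, 1}.
-- Colour (r, s, t, x) by the σ-parities of the paths t r x and t s x. Induced triangles have
-- σ-sum 0 and induced 4-cycles σ-sum 1; hence the colour (1, 1) never occurs, and R-related
-- quadruples get different colours, so R maps to K₃. Conversely an induced pentagon has σ-sum 1,
-- so one of its edges uv has σ = 1. Next to uv there are non-adjacent r, s and a triangle c, all
-- explicit rationals, with r and s adjacent to u, v and c, and c non-adjacent to u and v. The
-- triangle c has an edge t x₀ with σ = 0, and (r, s, t, z) for z = x₀, u, v is a copy of K₃ in R.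
module Submission where

open import Defs
open import Algebra.Bundles using (CommutativeRing)
open import Data.Bool as Bool using (Bool; true; false; not; _xor_)
open import Data.Bool.Properties using (xor-same; xor-comm; not-¬; ¬-not; xor-∧-commutativeRing)
open import Data.Empty using (⊥; ⊥-elim)
open import Data.Fin as Fin using (Fin)
open import Data.Fin.Patterns
import Data.Fin.Properties as Finₚ
open import Data.Integer as ℤ using (ℤ; +_; -[1+_])
open import Data.Nat as ℕ using (ℕ; suc)
import Data.Nat.Properties as ℕ
open import Data.Product using (Σ; ∃; _×_; _,_; proj₁; proj₂; uncurry; map₂)
open import Data.Product.Properties using (,-injective)
open import Data.Rational using (ℚ; _/_; _≤_; _<_; _+_; _-_; _*_; -_; ∣_∣; 0ℚ)
open import Data.Rational.Properties
  using (_≟_; _≤?_; _<?_; ≤-refl; ≤-trans; <-≤-trans; ≤-<-trans; module ≤-Reasoning;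
         +-assoc; +-identityʳ; +-inverseˡ; +-inverseʳ; +-monoˡ-≤; +-monoʳ-≤; +-0-group;
         ∣-p∣≡∣p∣; nonNegative⁻¹; normalize-nonNeg; toℚᵘ-cancel-≤; toℚᵘ-fromℚᵘ)
import Data.Rational.Unnormalised as ℚᵘ
import Data.Rational.Unnormalised.Properties as ℚᵘ
open import Data.Sum using (_⊎_; inj₁; inj₂)
open import Data.Vec using (Vec; _∷_; []; lookup; _++_)
open import Function using (_∘_)
open import Relation.Binary.Definitions using (Symmetric)
open import Relation.Binary.PropositionalEquality
open import Relation.Nullary using (¬_; Dec; yes; no; ¬?; _×-dec_; _⊎-dec_; _→-dec_)
open import Relation.Nullary.Decidable using (True; toWitness; from-yes; map′)

open import Algebra.Properties.Group +-0-group using (⁻¹-anti-homo-//)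
open CommutativeRing xor-∧-commutativeRing using (+-commutativeMonoid; +-group)
open import Algebra.Properties.Group +-group using (∙-cancelˡ)
open import Algebra.Solver.CommutativeMonoid +-commutativeMonoid using (solve; _⊜_; _⊕_; id)

-- The Leibniz series

alt : ℕ → ℤ
alt 0 = + 1
alt 1 = -[1+ 0 ]
alt (suc (suc k)) = alt k

alt-even : ∀ n → alt (2 ℕ.* n) ≡ + 1
alt-even 0 = refl
alt-even (suc n) = trans (cong alt (ℕ.*-suc 2 n)) (alt-even n)

alt-odd : ∀ n → alt (suc (2 ℕ.* n)) ≡ -[1+ 0 ]
alt-odd 0 = refl
alt-odd (suc n) = trans (cong (alt ∘ suc) (ℕ.*-suc 2 n)) (alt-odd n)

periodic : {A : Set} (G : ℕ → ℕ → A) (F : ℤ → A) →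
           (∀ p → G p 0 ≡ F (+ 1)) → (∀ p → G p 1 ≡ F -[1+ 0 ]) →
           (∀ p k → G p (suc (suc k)) ≡ G p k) → ∀ p k → G p k ≡ F (alt k)
periodic G F G0 G1 G2 p 0 = G0 p
periodic G F G0 G1 G2 p 1 = G1 p
periodic G F G0 G1 G2 p (suc (suc k)) = trans (G2 p k) (periodic G F G0 G1 G2 p k)

-- The sign in leibnizTerm is a where-bound function of Defs: it cannot be named here, and it
-- carries the argument of leibnizTerm as a hidden parameter p. Abstracting p and the
-- denominator d in the goal lets unification solve the meta leibnizForm as that expression.
mutual
  leibnizForm : ℕ → ℕ → ℕ → ℚ
  leibnizForm = _

  leibnizTerm-alt : ∀ j → leibnizTerm j ≡ (alt j ℤ.* + 4) / suc (2 ℕ.* j)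
  leibnizTerm-alt 0 = refl
  leibnizTerm-alt 1 = refl
  leibnizTerm-alt (suc (suc k)) with suc (suc k) | 2 ℕ.* suc (suc k)
  ... | p | d = cong-app (periodic leibnizForm (λ z d → (z ℤ.* + 4) / suc d)
                                   (λ _ → refl) (λ _ → refl) (λ _ _ → refl) p k) d

4/1+ : ℕ → ℚ
4/1+ a = + 4 / suc a

leibnizTerm-pos : ∀ j → alt j ≡ + 1 → leibnizTerm j ≡ 4/1+ (2 ℕ.* j)
leibnizTerm-pos j alt≡1 =
  trans (leibnizTerm-alt j) (cong (λ z → (z ℤ.* + 4) / suc (2 ℕ.* j)) alt≡1)

leibnizTerm-neg : ∀ j → alt j ≡ -[1+ 0 ] → leibnizTerm j ≡ - 4/1+ (2 ℕ.* j)
leibnizTerm-neg j alt≡-1 =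
  trans (leibnizTerm-alt j) (cong (λ z → (z ℤ.* + 4) / suc (2 ℕ.* j)) alt≡-1)

4/1+-nonNeg : ∀ a → 0ℚ ≤ 4/1+ a
4/1+-nonNeg a = nonNegative⁻¹ (4/1+ a) {{normalize-nonNeg 4 (suc a)}}

4/1+-antitone : ∀ {a b} → a ℕ.≤ b → 4/1+ b ≤ 4/1+ a
4/1+-antitone {a} {b} a≤b = toℚᵘ-cancel-≤
  (ℚᵘ.≤-respˡ-≃ (ℚᵘ.≃-sym (toℚᵘ-fromℚᵘ (ℚᵘ.mkℚᵘ (+ 4) b)))
    (ℚᵘ.≤-respʳ-≃ (ℚᵘ.≃-sym (toℚᵘ-fromℚᵘ (ℚᵘ.mkℚᵘ (+ 4) a)))
      (ℚᵘ.*≤* (ℤ.+≤+ (ℕ.*-monoʳ-≤ 4 (ℕ.s≤s a≤b))))))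

p≤p+q : ∀ p {q} → 0ℚ ≤ q → p ≤ p + q
p≤p+q p {q} 0≤q = subst (_≤ p + q) (+-identityʳ p) (+-monoʳ-≤ p 0≤q)

p≤p+q-r : ∀ p {q r} → r ≤ q → p ≤ (p + q) - r
p≤p+q-r p {q} {r} r≤q = begin
  p              ≤⟨ p≤p+q p (subst (_≤ q - r) (+-inverseʳ r) (+-monoˡ-≤ (- r) r≤q)) ⟩
  p + (q - r)    ≡⟨ +-assoc p q (- r) ⟨
  (p + q) - r    ∎
  where open ≤-Reasoning

p-r+q≤p : ∀ p {q r} → q ≤ r → (p - r) + q ≤ p
p-r+q≤p p {q} {r} q≤r = begin
  (p - r) + q    ≡⟨ +-assoc p (- r) q ⟩
  p + (- r + q)  ≤⟨ +-monoʳ-≤ p (subst (- r + q ≤_) (+-inverseˡ r) (+-monoʳ-≤ (- r) q≤r)) ⟩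
  p + 0ℚ         ≡⟨ +-identityʳ p ⟩
  p              ∎
  where open ≤-Reasoning

S-even≤S-odd : ∀ m → S (2 ℕ.* m) ≤ S (suc (2 ℕ.* m))
S-even≤S-odd m = subst (S (2 ℕ.* m) ≤_)
  (cong (λ q → S (2 ℕ.* m) + q) (sym (leibnizTerm-pos (2 ℕ.* m) (alt-even m))))
  (p≤p+q (S (2 ℕ.* m)) (4/1+-nonNeg (2 ℕ.* (2 ℕ.* m))))

S-even-mono : ∀ m → S (2 ℕ.* m) ≤ S (suc (suc (2 ℕ.* m)))
S-even-mono m = subst (S (2 ℕ.* m) ≤_)
  (sym (cong₂ (λ p q → (S (2 ℕ.* m) + p) + q)
              (leibnizTerm-pos (2 ℕ.* m) (alt-even m))
              (leibnizTerm-neg (suc (2 ℕ.* m)) (alt-odd m))))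
  (p≤p+q-r (S (2 ℕ.* m)) (4/1+-antitone (ℕ.*-monoʳ-≤ 2 (ℕ.n≤1+n (2 ℕ.* m)))))

S-odd-antitone : ∀ m → S (suc (suc (suc (2 ℕ.* m)))) ≤ S (suc (2 ℕ.* m))
S-odd-antitone m = subst (_≤ S (suc (2 ℕ.* m)))
  (sym (cong₂ (λ p q → (S (suc (2 ℕ.* m)) + p) + q)
              (leibnizTerm-neg (suc (2 ℕ.* m)) (alt-odd m))
              (leibnizTerm-pos (suc (suc (2 ℕ.* m))) (alt-even m))))
  (p-r+q≤p (S (suc (2 ℕ.* m))) (4/1+-antitone (ℕ.*-monoʳ-≤ 2 (ℕ.n≤1+n (suc (2 ℕ.* m))))))

module _ (s : ℕ → ℚ)
         (even-mono : ∀ m → s (2 ℕ.* m) ≤ s (suc (suc (2 ℕ.* m))))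
         (odd-antitone : ∀ m → s (suc (suc (suc (2 ℕ.* m)))) ≤ s (suc (2 ℕ.* m)))
         (even≤odd : ∀ m → s (2 ℕ.* m) ≤ s (suc (2 ℕ.* m))) where

  private
    even-mono* : ∀ k m → s (2 ℕ.* m) ≤ s (2 ℕ.* (k ℕ.+ m))
    even-mono* 0 m = ≤-refl
    even-mono* (suc k) m = ≤-trans (even-mono* k m)
      (subst (λ n → s (2 ℕ.* (k ℕ.+ m)) ≤ s n) (sym (ℕ.*-suc 2 (k ℕ.+ m))) (even-mono (k ℕ.+ m)))

    odd-antitone* : ∀ k n → s (suc (2 ℕ.* (k ℕ.+ n))) ≤ s (suc (2 ℕ.* n))
    odd-antitone* 0 n = ≤-refl
    odd-antitone* (suc k) n = ≤-trans
      (subst (λ m → s (suc m) ≤ s (suc (2 ℕ.* (k ℕ.+ n))))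
             (sym (ℕ.*-suc 2 (k ℕ.+ n))) (odd-antitone (k ℕ.+ n)))
      (odd-antitone* k n)

  even≤odd-everywhere : ∀ m n → s (2 ℕ.* m) ≤ s (suc (2 ℕ.* n))
  even≤odd-everywhere m n = begin
    s (2 ℕ.* m)                ≤⟨ even-mono* n m ⟩
    s (2 ℕ.* (n ℕ.+ m))        ≤⟨ even≤odd (n ℕ.+ m) ⟩
    s (suc (2 ℕ.* (n ℕ.+ m)))  ≡⟨ cong (λ k → s (suc (2 ℕ.* k))) (ℕ.+-comm n m) ⟩
    s (suc (2 ℕ.* (m ℕ.+ n)))  ≤⟨ odd-antitone* m n ⟩
    s (suc (2 ℕ.* n))          ∎
    where open ≤-Reasoning

S-even≤S-odd-everywhere : ∀ m n → S (2 ℕ.* m) ≤ S (suc (2 ℕ.* n))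
S-even≤S-odd-everywhere = even≤odd-everywhere S S-even-mono S-odd-antitone S-even≤S-odd

-- π₋ ≤ S 26 ≤ π ≤ S 27 ≤ π₊, so comparisons with π of concrete rationals outside
-- [π₋, π₊] become decidable comparisons with these two constants.
π₋ π₊ : ℚ
π₋ = + 31 / 10
π₊ = + 159 / 50

π₋≤S26 : π₋ ≤ S (2 ℕ.* 13)
π₋≤S26 = from-yes (π₋ ≤? S 26)

S27≤π₊ : S (suc (2 ℕ.* 13)) ≤ π₊
S27≤π₊ = from-yes (S 27 ≤? π₊)

<π₋⇒LtPi : ∀ {x} → x < π₋ → LtPi x
<π₋⇒LtPi x<π₋ = 13 , <-≤-trans x<π₋ π₋≤S26

π₊<⇒GtPi : ∀ {x} → π₊ < x → GtPi x
π₊<⇒GtPi π₊<x = 13 , ≤-<-trans S27≤π₊ π₊<x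

≤π₋⇒¬GtPi : ∀ {x} → x ≤ π₋ → ¬ GtPi x
≤π₋⇒¬GtPi {x} x≤π₋ (n , S<x) = begin-contradiction
  S (suc (2 ℕ.* n))  <⟨ S<x ⟩
  x                  ≤⟨ x≤π₋ ⟩
  π₋                 ≤⟨ π₋≤S26 ⟩
  S (2 ℕ.* 13)       ≤⟨ S-even≤S-odd-everywhere 13 n ⟩
  S (suc (2 ℕ.* n))  ∎
  where open ≤-Reasoning

π₊≤⇒¬LtPi : ∀ {x} → π₊ ≤ x → ¬ LtPi x
π₊≤⇒¬LtPi {x} π₊≤x (n , x<S) = begin-contradiction
  x                   <⟨ x<S ⟩
  S (2 ℕ.* n)         ≤⟨ S-even≤S-odd-everywhere n 13 ⟩
  S (suc (2 ℕ.* 13))  ≤⟨ S27≤π₊ ⟩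
  π₊                  ≤⟨ π₊≤x ⟩
  x                   ∎
  where open ≤-Reasoning

-- Vertices and adjacency

Δ : V → V → ℚ
Δ x y = ∣ arg x - arg y ∣

N : V → V → Set
N x y = arg x ≢ arg y × ¬ E x y

Δ-sym : ∀ x y → Δ x y ≡ Δ y x
Δ-sym x y = trans (sym (∣-p∣≡∣p∣ (arg x - arg y))) (cong ∣_∣ (⁻¹-anti-homo-// (arg x) (arg y)))

AdjC3-sym : Symmetric AdjC3
AdjC3-sym {x} {y} (x≢y , gt , lt) rewrite Δ-sym x y = x≢y ∘ sym , gt , lt

E-sym : Symmetric E
E-sym {x} {y} (x≢y , ¬adj) = x≢y ∘ sym , ¬adj ∘ AdjC3-sym {y} {x}

N-sym : Symmetric N
N-sym {x} {y} (x≢y , ¬e) = x≢y ∘ sym , ¬e ∘ E-sym {y} {x}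

-- For distinct x, y with d = Δ x y, E x y fails exactly when 2π/3 < d < 4π/3; the
-- certificates compare d with these bounds, replacing π by π₋ or π₊ on the safe side.
record EdgeCert (x y : V) : Set where
  constructor edgeCert
  field
    distinct : arg x ≢ arg y
    bound    : (+ 3 / 2) * Δ x y ≤ π₋ ⊎ π₊ ≤ (+ 3 / 4) * Δ x y

record NonEdgeCert (x y : V) : Set where
  constructor nonEdgeCert
  field
    distinct : arg x ≢ arg y
    lower    : π₊ < (+ 3 / 2) * Δ x y
    upper    : (+ 3 / 4) * Δ x y < π₋

EdgeCert⇒E : ∀ {x y} → EdgeCert x y → E x y
EdgeCert⇒E (edgeCert x≢y (inj₁ near)) = x≢y , λ (_ , gt , _) → ≤π₋⇒¬GtPi near gt
EdgeCert⇒E (edgeCert x≢y (inj₂ far))  = x≢y , λ (_ , _ , lt) → π₊≤⇒¬LtPi far lt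

NonEdgeCert⇒N : ∀ {x y} → NonEdgeCert x y → N x y
NonEdgeCert⇒N (nonEdgeCert x≢y gt lt) = x≢y , λ (_ , ¬adj) → ¬adj (x≢y , π₊<⇒GtPi gt , <π₋⇒LtPi lt)

edgeCert? : ∀ x y → Dec (EdgeCert x y)
edgeCert? x y = map′ (uncurry edgeCert) (λ (edgeCert d b) → d , b)
  (¬? (arg x ≟ arg y) ×-dec ((+ 3 / 2) * Δ x y ≤? π₋ ⊎-dec π₊ ≤? (+ 3 / 4) * Δ x y))

nonEdgeCert? : ∀ x y → Dec (NonEdgeCert x y)
nonEdgeCert? x y = map′ (λ (d , l , u) → nonEdgeCert d l u) (λ (nonEdgeCert d l u) → d , l , u)
  (¬? (arg x ≟ arg y) ×-dec π₊ <? (+ 3 / 2) * Δ x y ×-dec (+ 3 / 4) * Δ x y <? π₋)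

vertex : (q : ℚ) → {True (∣ q ∣ <? π₋)} → V
vertex q {q<π₋} = vtx q (<π₋⇒LtPi (toWitness q<π₋))

triple : {A : Set} → A → A → A → Fin 3 → A
triple a b c = lookup (a ∷ b ∷ c ∷ [])

triple-pairwise : ∀ {A : Set} {_∼_ : A → A → Set} → Symmetric _∼_ → ∀ {a b c} →
                  a ∼ b → a ∼ c → b ∼ c → ∀ i j → i ≢ j → triple a b c i ∼ triple a b c j
triple-pairwise sym∼ ab ac bc 0F 0F 0≢0 = ⊥-elim (0≢0 refl)
triple-pairwise sym∼ ab ac bc 0F 1F _   = ab
triple-pairwise sym∼ ab ac bc 0F 2F _   = ac
triple-pairwise sym∼ ab ac bc 1F 0F _   = sym∼ ab
triple-pairwise sym∼ ab ac bc 1F 1F 1≢1 = ⊥-elim (1≢1 refl)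
triple-pairwise sym∼ ab ac bc 1F 2F _   = bc
triple-pairwise sym∼ ab ac bc 2F 0F _   = sym∼ ac
triple-pairwise sym∼ ab ac bc 2F 1F _   = sym∼ bc
triple-pairwise sym∼ ab ac bc 2F 2F 2≢2 = ⊥-elim (2≢2 refl)

-- Induced cycles

NonAdjacent : ∀ {n} → Fin (suc n) → Fin (suc n) → Set
NonAdjacent i j = i ≢ j × j ≢ next i × i ≢ next j

nonAdjacent? : ∀ {n} (i j : Fin (suc n)) → Dec (NonAdjacent i j)
nonAdjacent? i j = ¬? (i Finₚ.≟ j) ×-dec ¬? (j Finₚ.≟ next i) ×-dec ¬? (i Finₚ.≟ next j)

inducedCycle : ∀ {m} (c : Fin (3 ℕ.+ m) → V) → (∀ i → E (c i) (c (next i))) →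
               (∀ i j → NonAdjacent i j → N (c i) (c j)) → InducedCycle c
inducedCycle c edge chordless = distinct , edge , adjacent
  where
  distinct : ∀ i j → i ≢ j → arg (c i) ≢ arg (c j)
  distinct i j i≢j with j Finₚ.≟ next i | i Finₚ.≟ next j
  ... | yes refl | _        = proj₁ (edge i)
  ... | no _     | yes refl = proj₁ (edge j) ∘ sym
  ... | no j≢i⁺  | no i≢j⁺  = proj₁ (chordless i j (i≢j , j≢i⁺ , i≢j⁺))

  adjacent : ∀ i j → E (c i) (c j) → j ≡ next i ⊎ i ≡ next j
  adjacent i j e with j Finₚ.≟ next i | i Finₚ.≟ next j | i Finₚ.≟ j
  ... | yes j≡i⁺ | _        | _        = inj₁ j≡i⁺
  ... | no _     | yes i≡j⁺ | _        = inj₂ i≡j⁺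
  ... | no _     | no _     | yes refl = ⊥-elim (proj₁ e refl)
  ... | no j≢i⁺  | no i≢j⁺  | no i≢j   = ⊥-elim (proj₂ (chordless i j (i≢j , j≢i⁺ , i≢j⁺)) e)

triangle-chordless : ∀ (i j : Fin 3) → ¬ NonAdjacent i j
triangle-chordless = from-yes (Finₚ.all? λ (i : Fin 3) → Finₚ.all? λ (j : Fin 3) → ¬? (nonAdjacent? i j))

square-chords : ∀ (i j : Fin 4) → NonAdjacent i j → j ≡ next (next i)
square-chords = from-yes (Finₚ.all? λ (i : Fin 4) → Finₚ.all? λ (j : Fin 4) →
                            nonAdjacent? i j →-dec j Finₚ.≟ next (next i))

triangle-induced : (c : Fin 3 → V) → (∀ i → E (c i) (c (next i))) → InducedCycle c
triangle-induced c edge = inducedCycle c edge λ i j → ⊥-elim ∘ triangle-chordless i j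

square-induced : (c : Fin 4 → V) → (∀ i → E (c i) (c (next i))) →
                 (∀ i → N (c i) (c (next (next i)))) → InducedCycle c
square-induced c edge opposite = inducedCycle c edge λ i j ij →
  subst (N (c i) ∘ c) (sym (square-chords i j ij)) (opposite i)

xorSum-cong : ∀ n {f g : Fin n → Bool} → (∀ i → f i ≡ g i) → xorSum n f ≡ xorSum n g
xorSum-cong 0 _ = refl
xorSum-cong (suc n) f≗g = cong₂ _xor_ (f≗g Fin.zero) (xorSum-cong n (f≗g ∘ Fin.suc))

xorSum-witness : ∀ n (f : Fin n → Bool) b → xorSum n f ≡ not (xorSum n (λ _ → b)) →
                 ∃ λ i → f i ≡ not b
xorSum-witness n f b sum≡ = map₂ ¬-not
  (Finₚ.¬∀⟶∃¬ n (λ i → f i ≡ b) (λ i → f i Bool.≟ b) λ f≗b → not-¬ (xorSum-cong n f≗b) sum≡)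

xor≡false⇒≡ : ∀ x y → x xor y ≡ false → x ≡ y
xor≡false⇒≡ false false _ = refl
xor≡false⇒≡ true  true  _ = refl

xor≡true⇒∧≡false : ∀ x y → x xor y ≡ true → x Bool.∧ y ≡ false
xor≡true⇒∧≡false false _     _ = refl
xor≡true⇒∧≡false true  false _ = refl

-- The pp-formula

⟪0,1⟫ ⟪N⟫ : Element
⟪0,1⟫ a0 = true
⟪0,1⟫ a1 = true
⟪0,1⟫ _  = false
⟪N⟫ aN = true
⟪N⟫ _  = false

⟪N,_⟫ : Bool → Element
⟪N, _     ⟫ aN = true
⟪N, false ⟫ a0 = true
⟪N, true  ⟫ a1 = true
⟪N, _     ⟫ _  = false

baseφ : ∀ {n} (r s t : Fin n) → PP n
baseφ r s t = rel ⟪N⟫ r s ∧ (rel ⟪0,1⟫ r t ∧ rel ⟪0,1⟫ s t)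

apexφ : ∀ {n} (r s t x : Fin n) → PP n
apexφ r s t x = rel ⟪0,1⟫ r x ∧ (rel ⟪0,1⟫ s x ∧ rel ⟪N, false ⟫ t x)

φ : PP 8
φ = eq 0F 4F ∧ (eq 1F 5F ∧ (eq 2F 6F ∧
    (baseφ 0F 1F 2F ∧ (apexφ 0F 1F 2F 3F ∧ (apexφ 0F 1F 2F 7F ∧ rel ⟪N, true ⟫ 3F 7F)))))

code : Bool → Bool → Fin 3
code false false = 0F
code true  false = 1F
code false true  = 2F
code true  true  = 0F  -- never used: exclusion rules out this colour

decode : Fin 3 → Bool × Bool
decode 0F = false , false
decode 1F = true  , false
decode 2F = false , true

decode-code : ∀ u v → u Bool.∧ v ≡ false → decode (code u v) ≡ (u , v)
decode-code false false _ = refl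
decode-code true  false _ = refl
decode-code false true  _ = refl

code-injective : ∀ {u v u′ v′} → u Bool.∧ v ≡ false → u′ Bool.∧ v′ ≡ false →
                 code u v ≡ code u′ v′ → u ≡ u′ × v ≡ v′
code-injective {u} {v} {u′} {v′} uv u′v′ same-code =
  ,-injective (trans (sym (decode-code u v uv)) (trans (cong decode same-code) (decode-code u′ v′ u′v′)))

-- The pentagon and the configurations next to its edges

record Gadget (u v : V) : Set where
  field
    r s     : V
    c       : Fin 3 → V
    r≁s     : N r s
    r~u     : E r u
    r~v     : E r v
    s~u     : E s u
    s~v     : E s v
    r~c     : ∀ i → E r (c i)
    s~c     : ∀ i → E s (c i)
    c≁u     : ∀ i → N (c i) u
    c≁v     : ∀ i → N (c i) v
    c-cycle : ∀ i → E (c i) (c (next i))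

GadgetCert : (u v r s : V) → (Fin 3 → V) → Set
GadgetCert u v r s c =
  NonEdgeCert r s × EdgeCert r u × EdgeCert r v × EdgeCert s u × EdgeCert s v ×
  (∀ i → EdgeCert r (c i)) × (∀ i → EdgeCert s (c i)) ×
  (∀ i → NonEdgeCert (c i) u) × (∀ i → NonEdgeCert (c i) v) × (∀ i → EdgeCert (c i) (c (next i)))

gadgetCert? : ∀ u v r s c → Dec (GadgetCert u v r s c)
gadgetCert? u v r s c =
  nonEdgeCert? r s ×-dec edgeCert? r u ×-dec edgeCert? r v ×-dec edgeCert? s u ×-dec edgeCert? s v ×-dec
  Finₚ.all? (edgeCert? r ∘ c) ×-dec Finₚ.all? (edgeCert? s ∘ c) ×-dec
  Finₚ.all? (λ i → nonEdgeCert? (c i) u) ×-dec Finₚ.all? (λ i → nonEdgeCert? (c i) v) ×-dec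
  Finₚ.all? (λ i → edgeCert? (c i) (c (next i)))

GadgetCert⇒Gadget : ∀ {u v} r s c → GadgetCert u v r s c → Gadget u v
GadgetCert⇒Gadget r s c (rs , ru , rv , su , sv , rc , sc , cu , cv , cc) = record
  { r = r ; s = s ; c = c
  ; r≁s = NonEdgeCert⇒N rs
  ; r~u = EdgeCert⇒E ru ; r~v = EdgeCert⇒E rv ; s~u = EdgeCert⇒E su ; s~v = EdgeCert⇒E sv
  ; r~c = EdgeCert⇒E ∘ rc ; s~c = EdgeCert⇒E ∘ sc
  ; c≁u = NonEdgeCert⇒N ∘ cu ; c≁v = NonEdgeCert⇒N ∘ cv
  ; c-cycle = EdgeCert⇒E ∘ cc
  }

gadget! : ∀ {u v} r s c → {True (gadgetCert? u v r s c)} → Gadget u v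
gadget! r s c {ok} = GadgetCert⇒Gadget r s c (toWitness ok)

pentagon : Fin 5 → V
pentagon = lookup (vertex (- (+ 5 / 2)) ∷ vertex (- (+ 5 / 4)) ∷ vertex 0ℚ ∷
                   vertex (+ 5 / 4) ∷ vertex (+ 5 / 2) ∷ [])

pentagon-edge : ∀ i → E (pentagon i) (pentagon (next i))
pentagon-edge = EdgeCert⇒E ∘ from-yes (Finₚ.all? λ i → edgeCert? (pentagon i) (pentagon (next i)))

pentagon-chordless : ∀ i j → NonAdjacent i j → N (pentagon i) (pentagon j)
pentagon-chordless i j = NonEdgeCert⇒N ∘ from-yes (Finₚ.all? λ k → Finₚ.all? λ l →
  nonAdjacent? k l →-dec nonEdgeCert? (pentagon k) (pentagon l)) i j

pentagon-induced : InducedCycle {2} pentagon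
pentagon-induced = inducedCycle pentagon pentagon-edge pentagon-chordless

gadget : ∀ i → Gadget (pentagon i) (pentagon (next i))
gadget 0F = gadget! (vertex (- (+ 53 / 100))) (vertex (+ 307 / 100))
                    (triple (vertex (+ 5 / 4)) (vertex (+ 127 / 100)) (vertex (+ 129 / 100)))
gadget 1F = gadget! (vertex (+ 18 / 25)) (vertex (- (+ 197 / 100)))
                    (triple (vertex (+ 5 / 2)) (vertex (+ 63 / 25)) (vertex (+ 127 / 50)))
gadget 2F = gadget! (vertex (+ 197 / 100)) (vertex (- (+ 18 / 25)))
                    (triple (vertex (- (+ 127 / 50))) (vertex (- (+ 63 / 25))) (vertex (- (+ 5 / 2))))
gadget 3F = gadget! (vertex (- (+ 307 / 100))) (vertex (+ 53 / 100))
                    (triple (vertex (- (+ 129 / 100))) (vertex (- (+ 127 / 100))) (vertex (- (+ 5 / 4))))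
gadget 4F = gadget! (vertex (- (+ 9 / 5))) (vertex (+ 9 / 5))
                    (triple (vertex (- (+ 1 / 50))) (vertex 0ℚ) (vertex (+ 1 / 50)))

-- Consequences of anti-even-balancing

module Labelling (σ : V → V → Bool) (σ-sym : SymmetricOnEdges σ) (aeb : AntiEvenBalancing σ) where

  pathParity : V → V → V → Bool
  pathParity a b c = σ a b xor σ b c

  triangle-parity : ∀ {a b c} → E a b → E b c → E a c → pathParity a b c ≡ σ a c
  triangle-parity {a} {b} {c} ab bc ac = xor≡false⇒≡ (pathParity a b c) (σ a c) (begin
    pathParity a b c xor σ a c
      ≡⟨ cong (pathParity a b c xor_) (σ-sym a c ac) ⟩
    (σ a b xor σ b c) xor σ c a
      ≡⟨ solve 3 (λ x y z → (x ⊕ y) ⊕ z ⊜ x ⊕ (y ⊕ (z ⊕ id))) refl (σ a b) (σ b c) (σ c a) ⟩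
    σ a b xor (σ b c xor (σ c a xor false))
      ≡⟨ aeb 0 (triple a b c) (triangle-induced (triple a b c) edge) ⟩
    false
      ∎)
    where
    open ≡-Reasoning
    edge : ∀ i → E (triple a b c i) (triple a b c (next i))
    edge 0F = ab
    edge 1F = bc
    edge 2F = E-sym {a} {c} ac

  square-parity : ∀ {a b c d} → E a b → E b c → E a d → E d c → N a c → N b d →
                  pathParity a b c xor pathParity a d c ≡ true
  square-parity {a} {b} {c} {d} ab bc ad dc a≁c b≁d = begin
    pathParity a b c xor (σ a d xor σ d c)
      ≡⟨ cong₂ (λ p q → pathParity a b c xor (p xor q)) (σ-sym a d ad) (σ-sym d c dc) ⟩
    (σ a b xor σ b c) xor (σ d a xor σ c d)
      ≡⟨ solve 4 (λ w x y z → (w ⊕ x) ⊕ (z ⊕ y) ⊜ w ⊕ (x ⊕ (y ⊕ (z ⊕ id)))) refl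
                 (σ a b) (σ b c) (σ c d) (σ d a) ⟩
    σ a b xor (σ b c xor (σ c d xor (σ d a xor false)))
      ≡⟨ aeb 1 square (square-induced square edge opposite) ⟩
    true
      ∎
    where
    open ≡-Reasoning
    square : Fin 4 → V
    square = lookup (a ∷ b ∷ c ∷ d ∷ [])
    edge : ∀ i → E (square i) (square (next i))
    edge 0F = ab
    edge 1F = bc
    edge 2F = E-sym {d} {c} dc
    edge 3F = E-sym {a} {d} ad
    opposite : ∀ i → N (square i) (square (next (next i)))
    opposite 0F = a≁c
    opposite 1F = b≁d
    opposite 2F = N-sym {a} {c} a≁c
    opposite 3F = N-sym {b} {d} b≁d

  N∪ : Bool → V → V → Set
  N∪ b x y = N x y ⊎ (E x y × σ x y ≡ b)

  N∪-sym : ∀ b → Symmetric (N∪ b)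
  N∪-sym _ {x} {y} (inj₁ x≁y) = inj₁ (N-sym {x} {y} x≁y)
  N∪-sym _ {x} {y} (inj₂ (x~y , σxy)) = inj₂ (E-sym {x} {y} x~y , trans (sym (σ-sym x y x~y)) σxy)

  record Base (r s t : V) : Set where
    constructor base
    field
      r≁s : N r s
      r~t : E r t
      s~t : E s t

  record Apex (r s t x : V) : Set where
    constructor apex
    field
      r~x : E r x
      s~x : E s x
      t≁x : N∪ false t x

  exclusion : ∀ {r s t x} → Base r s t → Apex r s t x → pathParity t r x Bool.∧ pathParity t s x ≡ false
  exclusion {r} {s} {t} {x} (base r≁s r~t s~t) (apex r~x s~x (inj₂ (t~x , σtx≡0))) =
    cong (Bool._∧ pathParity t s x) (trans (triangle-parity (E-sym {r} {t} r~t) r~x t~x) σtx≡0)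
  exclusion {r} {s} {t} {x} (base r≁s r~t s~t) (apex r~x s~x (inj₁ t≁x)) =
    xor≡true⇒∧≡false (pathParity t r x) (pathParity t s x)
      (square-parity (E-sym {r} {t} r~t) r~x (E-sym {s} {t} s~t) s~x t≁x r≁s)

  separation : ∀ {r s t x y} → Base r s t → Apex r s t x → Apex r s t y → N∪ true x y →
               pathParity t r x ≡ pathParity t r y → pathParity t s x ≡ pathParity t s y → ⊥
  separation {r} {s} {t} {x} {y} _ (apex r~x _ _) (apex r~y _ _) (inj₂ (x~y , σxy≡1)) rx _ =
    not-¬ refl (begin
      σ r x            ≡⟨ ∙-cancelˡ (σ t r) (σ r x) (σ r y) rx ⟩
      σ r y            ≡⟨ triangle-parity r~x x~y r~y ⟨
      σ r x xor σ x y  ≡⟨ cong (σ r x xor_) σxy≡1 ⟩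
      σ r x xor true   ≡⟨ xor-comm (σ r x) true ⟩
      not (σ r x)      ∎)
    where open ≡-Reasoning
  separation {r} {s} {t} {x} {y} (base r≁s _ _) (apex r~x s~x _) (apex r~y s~y _) (inj₁ x≁y) rx sx =
    not-¬ paths-agree (square-parity r~x x~s r~y y~s r≁s x≁y)
    where
    open ≡-Reasoning
    x~s : E x s
    x~s = E-sym {s} {x} s~x
    y~s : E y s
    y~s = E-sym {s} {y} s~y
    σxs≡σys : σ x s ≡ σ y s
    σxs≡σys = begin
      σ x s  ≡⟨ σ-sym x s x~s ⟩
      σ s x  ≡⟨ ∙-cancelˡ (σ t s) (σ s x) (σ s y) sx ⟩
      σ s y  ≡⟨ σ-sym y s y~s ⟨
      σ y s  ∎
    paths-agree : pathParity r x s xor pathParity r y s ≡ false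
    paths-agree = trans
      (cong₂ (λ p q → (p xor q) xor pathParity r y s) (∙-cancelˡ (σ t r) (σ r x) (σ r y) rx) σxs≡σys)
      (xor-same (pathParity r y s))

  ⟪0,1⟫-sound : ∀ {x y} → Rel𝔅 σ ⟪0,1⟫ x y → E x y
  ⟪0,1⟫-sound (a0 , _ , _ , x~y , _) = x~y
  ⟪0,1⟫-sound (a1 , _ , _ , x~y , _) = x~y

  ⟪0,1⟫-complete : ∀ {x y} → E x y → Rel𝔅 σ ⟪0,1⟫ x y
  ⟪0,1⟫-complete {x} {y} x~y with σ x y in σxy
  ... | false = a0 , refl , proj₁ x~y , x~y , σxy
  ... | true  = a1 , refl , proj₁ x~y , x~y , σxy

  ⟪N⟫-sound : ∀ {x y} → Rel𝔅 σ ⟪N⟫ x y → N x y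
  ⟪N⟫-sound (aN , _ , x≁y) = x≁y

  ⟪N,_⟫-sound : ∀ b {x y} → Rel𝔅 σ ⟪N, b ⟫ x y → N∪ b x y
  ⟪N, _     ⟫-sound (aN , _ , x≁y) = inj₁ x≁y
  ⟪N, false ⟫-sound (a0 , _ , _ , x~y , σxy) = inj₂ (x~y , σxy)
  ⟪N, true  ⟫-sound (a1 , _ , _ , x~y , σxy) = inj₂ (x~y , σxy)

  ⟪N,_⟫-complete : ∀ b {x y} → N∪ b x y → Rel𝔅 σ ⟪N, b ⟫ x y
  ⟪N, b     ⟫-complete (inj₁ x≁y) = aN , refl , x≁y
  ⟪N, false ⟫-complete (inj₂ (x~y , σxy)) = a0 , refl , proj₁ x~y , x~y , σxy
  ⟪N, true  ⟫-complete (inj₂ (x~y , σxy)) = a1 , refl , proj₁ x~y , x~y , σxy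

  baseφ-sound : ∀ {n} (r s t : Fin n) ρ → ⟦ baseφ r s t ⟧ σ ρ → Base (ρ r) (ρ s) (ρ t)
  baseφ-sound r s t ρ (rs , rt , st) = base (⟪N⟫-sound rs) (⟪0,1⟫-sound rt) (⟪0,1⟫-sound st)

  baseφ-complete : ∀ {n} (r s t : Fin n) ρ → Base (ρ r) (ρ s) (ρ t) → ⟦ baseφ r s t ⟧ σ ρ
  baseφ-complete r s t ρ (base r≁s r~t s~t) = (aN , refl , r≁s) , ⟪0,1⟫-complete r~t , ⟪0,1⟫-complete s~t

  apexφ-sound : ∀ {n} (r s t x : Fin n) ρ → ⟦ apexφ r s t x ⟧ σ ρ → Apex (ρ r) (ρ s) (ρ t) (ρ x)
  apexφ-sound r s t x ρ (rx , sx , tx) = apex (⟪0,1⟫-sound rx) (⟪0,1⟫-sound sx) (⟪N, false ⟫-sound tx)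

  apexφ-complete : ∀ {n} (r s t x : Fin n) ρ → Apex (ρ r) (ρ s) (ρ t) (ρ x) → ⟦ apexφ r s t x ⟧ σ ρ
  apexφ-complete r s t x ρ (apex r~x s~x t≁x) =
    ⟪0,1⟫-complete r~x , ⟪0,1⟫-complete s~x , ⟪N, false ⟫-complete t≁x

  R : Vec V 4 → Vec V 4 → Set
  R a b = ⟦ φ ⟧ σ (lookup (a ++ b))

  R-sound : ∀ {r s t x r′ s′ t′ y} → R (r ∷ s ∷ t ∷ x ∷ []) (r′ ∷ s′ ∷ t′ ∷ y ∷ []) →
            r ≡ r′ × s ≡ s′ × t ≡ t′ × Base r s t × Apex r s t x × Apex r s t y × N∪ true x y
  R-sound {r} {s} {t} {x} {r′} {s′} {t′} {y} (r≡r′ , s≡s′ , t≡t′ , rst , rstx , rsty , xy) =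
    r≡r′ , s≡s′ , t≡t′ , baseφ-sound 0F 1F 2F ρ rst ,
    apexφ-sound 0F 1F 2F 3F ρ rstx , apexφ-sound 0F 1F 2F 7F ρ rsty , ⟪N, true ⟫-sound xy
    where
    ρ : Fin 8 → V
    ρ = lookup (r ∷ s ∷ t ∷ x ∷ r′ ∷ s′ ∷ t′ ∷ y ∷ [])

  R-complete : ∀ {r s t x y} → Base r s t → Apex r s t x → Apex r s t y → N∪ true x y →
               R (r ∷ s ∷ t ∷ x ∷ []) (r ∷ s ∷ t ∷ y ∷ [])
  R-complete {r} {s} {t} {x} {y} rst rstx rsty xy =
    refl , refl , refl , baseφ-complete 0F 1F 2F ρ rst ,
    apexφ-complete 0F 1F 2F 3F ρ rstx , apexφ-complete 0F 1F 2F 7F ρ rsty , ⟪N, true ⟫-complete xy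
    where
    ρ : Fin 8 → V
    ρ = lookup (r ∷ s ∷ t ∷ x ∷ r ∷ s ∷ t ∷ y ∷ [])

  colour : Vec V 4 → Fin 3
  colour (r ∷ s ∷ t ∷ x ∷ []) = code (pathParity t r x) (pathParity t s x)

  colour-hom : ∀ a b → R a b → colour a ≢ colour b
  colour-hom (r ∷ s ∷ t ∷ x ∷ []) (r′ ∷ s′ ∷ t′ ∷ y ∷ []) Rab same-colour with R-sound Rab
  ... | refl , refl , refl , rst , rstx , rsty , xy =
    let rx , sx = code-injective (exclusion rst rstx) (exclusion rst rsty) same-colour
    in separation rst rstx rsty xy rx sx

  record Fan : Set where
    field
      r s t  : V
      x      : Fin 3 → V
      frame  : Base r s t
      apexes : ∀ i → Apex r s t (x i)
      spread : ∀ i j → i ≢ j → N∪ true (x i) (x j)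

  Fan⇒K3 : Fan → Σ (Fin 3 → Vec V 4) λ g → ∀ i j → i ≢ j → R (g i) (g j)
  Fan⇒K3 F = (λ i → r ∷ s ∷ t ∷ x i ∷ []) ,
              λ i j i≢j → R-complete frame (apexes i) (apexes j) (spread i j i≢j)
    where open Fan F

  Gadget⇒Fan : ∀ {u v} → Gadget u v → E u v → σ u v ≡ true → Fan
  Gadget⇒Fan {u} {v} G u~v σuv≡1 = fan-at (xorSum-witness 3 _ true (aeb 0 c (triangle-induced c c-cycle)))
    where
    open Gadget G
    fan-at : ∃ (λ i → σ (c i) (c (next i)) ≡ false) → Fan
    fan-at (i , σ≡0) = record
      { r = r ; s = s ; t = c i ; x = triple (c (next i)) u v
      ; frame  = base r≁s (r~c i) (s~c i)
      ; apexes = λ where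
          0F → apex (r~c (next i)) (s~c (next i)) (inj₂ (c-cycle i , σ≡0))
          1F → apex r~u s~u (inj₁ (c≁u i))
          2F → apex r~v s~v (inj₁ (c≁v i))
      ; spread = triple-pairwise {_∼_ = N∪ true} (N∪-sym true) {c (next i)} {u} {v}
                   (inj₁ (c≁u (next i))) (inj₁ (c≁v (next i))) (inj₂ (u~v , σuv≡1))
      }

  fan : Fan
  fan with xorSum-witness 5 _ false (aeb 2 pentagon pentagon-induced)
  ... | i , σ≡1 = Gadget⇒Fan (gadget i) (pentagon-edge i) σ≡1

theorem6p1 : (i : V → Bool) → Dense i false → Dense i true →
    (P : Fin 5 → V) → InducedCycle {2} P →
    (σ : V → V → Bool) → SymmetricOnEdges σ → AntiEvenBalancing σ → ExtendsT i P σ →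
    PPConstructsK3 σ
theorem6p1 _ _ _ _ _ σ σ-sym aeb _ = 3 , φ , (colour , colour-hom) , Fan⇒K3 fan
  where open Labelling σ σ-sym aeb
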